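{- Let $G$ be a finite simple chordal graph (every induced cycle of $G$ has length three). If $G$ is vertex decomposable, then $\mathrm{Shed}(G)$ is a dominating set of $G$.
   Context: All graphs are finite and simple. For a graph $G=(V,E)$ and $x\in V$, $G\setminus x$ is the graph obtained by deleting $x$ and its incident edges; $N(x)$ is the set of neighbours of $x$, $N[x]=N(x)\cup\{x\}$, and $G\setminus N[x]$ is obtained by deleting all vertices of $N[x]$ and their incident edges. A graph is well-covered if all its maximal independent sets have the same cardinality. A graph $G$ is vertex decomposable if $G$ is well-covered and either (i) $G$ has no edges (possibly no vertices), or (ii) there is a vertex $x$ such that both $G\setminus x$ and $G\setminus N[x]$ are vertex decomposable. For a vertex decomposable graph $G$, $\mathrm{Shed}(G)$ is the set of vertices $x$ such that $G\setminus x$ and $G\setminus N[x]$ are both vertex decomposable. A set $D\subseteq V$ is dominating if every vertex of $V\setminus D$ is adjacent to a vertex of $D$. -}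

module Defs where

open import Data.Nat using (ℕ; suc; _+_; _%_)
open import Data.Bool using (Bool; T; _∨_)
open import Data.Fin using (Fin; toℕ)
open import Data.Fin.Properties using (_≟_)
open import Data.Fin.Subset using (Subset; _∈_; _∉_; _─_; _-_; ∣_∣; ⊤)
open import Data.Vec using (tabulate)
open import Data.Product using (Σ; ∃; _×_; _,_)
open import Data.Sum using (_⊎_)
open import Data.Empty using (⊥)
open import Relation.Nullary using (¬_)
open import Relation.Nullary.Decidable using (⌊_⌋)
open import Relation.Binary.PropositionalEquality using (_≡_)
open import Function.Definitions using (Injective)

record Graph (n : ℕ) : Set where
  field
    E     : Fin n → Fin n → Bool
    sym   : ∀ x y → E x y ≡ E y x
    irrefl : ∀ x → E x x ≡ Data.Bool.false

open Graph public

module _ {n : ℕ} (G : Graph n) where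

  Adj : Fin n → Fin n → Set
  Adj x y = T (E G x y)

  closedNbhd : Fin n → Subset n
  closedNbhd x = tabulate (λ y → ⌊ x ≟ y ⌋ ∨ E G x y)

  -- All notions below refer to the induced subgraph G[S] on a vertex set S.
  -- G[S] \ x  is  G[S - x], and  G[S] \ N[x]  is  G[S ─ N[x]].

  Independent : Subset n → Subset n → Set
  Independent S I = (∀ x → x ∈ I → x ∈ S) × (∀ x y → x ∈ I → y ∈ I → ¬ Adj x y)

  MaximalIndependent : Subset n → Subset n → Set
  MaximalIndependent S I =
    Independent S I ×
    (∀ v → v ∈ S → v ∉ I → Σ (Fin n) λ u → u ∈ I × Adj u v)

  WellCovered : Subset n → Set
  WellCovered S = ∀ I J → MaximalIndependent S I → MaximalIndependent S J → ∣ I ∣ ≡ ∣ J ∣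

  NoEdges : Subset n → Set
  NoEdges S = ∀ x y → x ∈ S → y ∈ S → ¬ Adj x y

  data VertexDecomposable (S : Subset n) : Set where
    vd-edgeless : WellCovered S → NoEdges S → VertexDecomposable S
    vd-shed     : WellCovered S → (x : Fin n) → x ∈ S →
                  VertexDecomposable (S - x) →
                  VertexDecomposable (S ─ closedNbhd x) →
                  VertexDecomposable S

  InShed : Subset n → Fin n → Set
  InShed S x = x ∈ S × VertexDecomposable (S - x) × VertexDecomposable (S ─ closedNbhd x)

  Dominating : Subset n → (Fin n → Set) → Set
  Dominating S D = ∀ v → v ∈ S → ¬ D v → Σ (Fin n) λ u → D u × u ∈ S × Adj u v

  -- Induced cycle of length k = m + 3: an injective cyclic sequence of vertices
  -- in which two vertices are adjacent iff they are cyclically consecutive.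
  CyclicConsecutive : (m : ℕ) → Fin (m + 3) → Fin (m + 3) → Set
  CyclicConsecutive m i j =
    (toℕ j ≡ (toℕ i + 1) % suc (suc (suc m))) ⊎ (toℕ i ≡ (toℕ j + 1) % suc (suc (suc m)))

  IsInducedCycle : (m : ℕ) → (Fin (m + 3) → Fin n) → Set
  IsInducedCycle m c =
    Injective _≡_ _≡_ c ×
    (∀ i j → CyclicConsecutive m i j → Adj (c i) (c j)) ×
    (∀ i j → Adj (c i) (c j) → CyclicConsecutive m i j)

  Chordal : Set
  Chordal = ∀ m (c : Fin (m + 3) → Fin n) → IsInducedCycle m c → m + 3 ≡ 3

module Submission where

-- Everything is phrased for induced subgraphs G[S], S ⊆ V; chordality of G
-- passes to all of them.  The argument:
--  * In a chordal graph there is no "detour" around a vertex r (a walk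
--    between two non-adjacent neighbours of r avoiding N[r] inside): a
--    shortest one would close up through r to an induced cycle of length ≥ 4.
--  * Dirac: every G[S] ⊄ Q (Q a clique) has a simplicial vertex outside Q.
--  * Deleting N[s] preserves well-coveredness, and so does deleting a
--    neighbour of a simplicial vertex s.
--  * In a well-covered chordal graph every vertex lies in N[s] for some
--    simplicial s (via a least dominating set with private neighbours).
--  * Hence well-covered chordal graphs are vertex decomposable, and every
--    neighbour of a simplicial vertex (or an isolated vertex) is a shedding
--    vertex.  A vertex outside Shed is therefore a simplicial vertex with a
--    neighbour, which is in Shed.

open import Defs hiding (sym)
open import Data.Nat using (ℕ; zero; suc; _+_; _≤_; _<_; z≤n; s≤s; z<s; _%_; _≤?_; _<?_)
open import Data.Nat.Properties
open import Data.Nat.DivMod using (m<n⇒m%n≡m; n%n≡0)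
open import Data.Nat.Tactic.RingSolver using (solve-∀)
open import Data.Nat.Induction using (<-rec)
open import Data.Bool using (true; false; T; _∨_)
open import Data.Bool.Properties using (T?)
open import Data.Fin using (Fin; toℕ) renaming (zero to fzero; suc to fsuc)
open import Data.Fin.Properties using (toℕ-injective; toℕ<n; any?; all?) renaming (_≟_ to _≟ᶠ_)
open import Data.Fin.Subset using (Subset; _⊆_; _∈_; _∉_; _─_; _-_; _∪_; _∩_; ∣_∣; ⁅_⁆; ⊤) renaming (⊥ to ∅)
open import Data.Fin.Subset.Properties
open import Data.Vec using (_∷_; here; there; tabulate)
open import Data.Vec.Properties using (lookup⇒[]=; []=⇒lookup; lookup∘tabulate)
open import Data.Product using (Σ; ∃; _×_; _,_; proj₁; proj₂)
open import Data.Sum using (_⊎_; inj₁; inj₂; [_,_])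
open import Data.Empty using (⊥; ⊥-elim)
open import Relation.Nullary using (¬_; Dec; yes; no)
open import Relation.Nullary.Decidable using (⌊_⌋; _×-dec_; _⊎-dec_; _→-dec_; ¬?)
open import Relation.Binary.Definitions using (tri<; tri≈; tri>)
open import Relation.Binary.PropositionalEquality using (_≡_; _≢_; refl; sym; trans; cong; subst; module ≡-Reasoning)

x∈p─q⇒x∉q : ∀ {n} {x : Fin n} (p q : Subset n) → x ∈ p ─ q → x ∉ q
x∈p─q⇒x∉q {x = fzero}  (_ ∷ p) (true ∷ q)  ()
x∈p─q⇒x∉q {x = fzero}  (_ ∷ p) (false ∷ q) here ()
x∈p─q⇒x∉q {x = fsuc x} (_ ∷ p) (_ ∷ q)     (there x∈) (there x∈q) = x∈p─q⇒x∉q p q x∈ x∈q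

x∈p-y⇒x≢y : ∀ {n} {x y : Fin n} (p : Subset n) → x ∈ p - y → x ≢ y
x∈p-y⇒x≢y {y = y} p x∈ refl = x∈p─q⇒x∉q p ⁅ y ⁆ x∈ (x∈⁅x⁆ y)

x∈p∪⁅y⁆⁻ : ∀ {n} {x y : Fin n} (p : Subset n) → x ∈ p ∪ ⁅ y ⁆ → x ∈ p ⊎ x ≡ y
x∈p∪⁅y⁆⁻ {y = y} p x∈ with x∈p∪q⁻ p ⁅ y ⁆ x∈
... | inj₁ x∈p = inj₁ x∈p
... | inj₂ x∈y = inj₂ (x∈⁅y⁆⇒x≡y y x∈y)

x∈p⇒x∈p∪⁅y⁆ : ∀ {n} {x : Fin n} (y : Fin n) {p : Subset n} → x ∈ p → x ∈ p ∪ ⁅ y ⁆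
x∈p⇒x∈p∪⁅y⁆ y x∈p = x∈p∪q⁺ (inj₁ x∈p)

y∈p∪⁅y⁆ : ∀ {n} (y : Fin n) {p : Subset n} → y ∈ p ∪ ⁅ y ⁆
y∈p∪⁅y⁆ y = x∈p∪q⁺ (inj₂ (x∈⁅x⁆ y))

∣p∪⁅x⁆∣≡1+∣p∣ : ∀ {n} (x : Fin n) (p : Subset n) → x ∉ p → ∣ p ∪ ⁅ x ⁆ ∣ ≡ suc ∣ p ∣
∣p∪⁅x⁆∣≡1+∣p∣ fzero    (true ∷ p)  x∉p = ⊥-elim (x∉p here)
∣p∪⁅x⁆∣≡1+∣p∣ fzero    (false ∷ p) x∉p = cong (λ q → suc ∣ q ∣) (∪-identityʳ p)
∣p∪⁅x⁆∣≡1+∣p∣ (fsuc x) (true ∷ p)  x∉p = cong suc (∣p∪⁅x⁆∣≡1+∣p∣ x p (λ x∈ → x∉p (there x∈)))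
∣p∪⁅x⁆∣≡1+∣p∣ (fsuc x) (false ∷ p) x∉p = ∣p∪⁅x⁆∣≡1+∣p∣ x p (λ x∈ → x∉p (there x∈))

∣p∪⁅x⁆∣≤1+∣p∣ : ∀ {n} (x : Fin n) (p : Subset n) → ∣ p ∪ ⁅ x ⁆ ∣ ≤ suc ∣ p ∣
∣p∪⁅x⁆∣≤1+∣p∣ fzero    (true ∷ p)  = s≤s (≤-trans (≤-reflexive (cong ∣_∣ (∪-identityʳ p))) (n≤1+n _))
∣p∪⁅x⁆∣≤1+∣p∣ fzero    (false ∷ p) = s≤s (≤-reflexive (cong ∣_∣ (∪-identityʳ p)))
∣p∪⁅x⁆∣≤1+∣p∣ (fsuc x) (true ∷ p)  = s≤s (∣p∪⁅x⁆∣≤1+∣p∣ x p)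
∣p∪⁅x⁆∣≤1+∣p∣ (fsuc x) (false ∷ p) = ∣p∪⁅x⁆∣≤1+∣p∣ x p

-- The subset of vertices satisfying a decidable predicate.  It is kept
-- abstract so that its tabulated form is never unfolded during checking.
module _ {n : ℕ} where
  abstract
    subsetOf : {P : Fin n → Set} → (∀ x → Dec (P x)) → Subset n
    subsetOf P? = tabulate (λ x → ⌊ P? x ⌋)

    ∈subsetOf⁺ : {P : Fin n → Set} (P? : ∀ x → Dec (P x)) {x : Fin n} → P x → x ∈ subsetOf P?
    ∈subsetOf⁺ {P} P? {x} px = lookup⇒[]= x _ (trans (lookup∘tabulate _ x) (isTrue (P? x)))
      where
      isTrue : (d : Dec (P x)) → ⌊ d ⌋ ≡ true
      isTrue (yes _) = refl
      isTrue (no ¬px) = ⊥-elim (¬px px)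

    ∈subsetOf⁻ : {P : Fin n → Set} (P? : ∀ x → Dec (P x)) {x : Fin n} → x ∈ subsetOf P? → P x
    ∈subsetOf⁻ {P} P? {x} x∈ = fromTrue (P? x) (trans (sym (lookup∘tabulate _ x)) ([]=⇒lookup x∈))
      where
      fromTrue : (d : Dec (P x)) → ⌊ d ⌋ ≡ true → P x
      fromTrue (yes px) _ = px
      fromTrue (no _) ()

  abstract
    leastSubset : (P : Subset n → Set) → (∀ X → Dec (P X)) → ∀ X₀ → P X₀ →
      ∃ λ X → P X × (∀ Y → P Y → ∣ X ∣ ≤ ∣ Y ∣)
    leastSubset P P? X₀ pX₀ = <-rec Goal descend ∣ X₀ ∣ X₀ ≤-refl pX₀
      where
      Goal : ℕ → Set
      Goal k = ∀ X → ∣ X ∣ ≤ k → P X → ∃ λ X → P X × (∀ Y → P Y → ∣ X ∣ ≤ ∣ Y ∣)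
      descend : ∀ k → (∀ {j} → j < k → Goal j) → Goal k
      descend k rec X ∣X∣≤k pX with anySubset? (λ Y → P? Y ×-dec (∣ Y ∣ <? ∣ X ∣))
      ... | yes (Y , pY , Y<X) = rec (<-≤-trans Y<X ∣X∣≤k) Y ≤-refl pY
      ... | no ¬smaller = X , pX , λ Y pY → ≮⇒≥ (λ Y<X → ¬smaller (Y , pY , Y<X))

-- An increasing chain of subsets of Fin n stops growing at some stage:
-- otherwise its k-th member would have at least k elements for k ≤ n + 1.
abstract
  chain-stabilises : ∀ {n} (R : ℕ → Subset n) → (∀ k → R k ⊆ R (suc k)) → ∃ λ k → R (suc k) ⊆ R k
  chain-stabilises {n} R increasing with anyUpTo? (λ k → R (suc k) ⊆? R k) (suc n)
  ... | yes (k , _ , stable) = k , stable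
  ... | no growing = ⊥-elim (<⇒≱ (large (suc n) ≤-refl) (∣p∣≤n (R (suc n))))
    where
    strict : ∀ k → k < suc n → ∣ R k ∣ < ∣ R (suc k) ∣
    strict k k<1+n with any? (λ x → (x ∈? R (suc k)) ×-dec ¬? (x ∈? R k))
    ... | yes new = p⊂q⇒∣p∣<∣q∣ (increasing k , new)
    ... | no none = ⊥-elim (growing (k , k<1+n , old))
      where
      old : R (suc k) ⊆ R k
      old {x} x∈ with x ∈? R k
      ... | yes x∈R = x∈R
      ... | no x∉R = ⊥-elim (none (x , x∈ , x∉R))
    large : ∀ k → k ≤ suc n → k ≤ ∣ R k ∣
    large zero    _         = z≤n
    large (suc k) 1+k≤1+n = ≤-<-trans (large k (≤-trans (n≤1+n k) 1+k≤1+n)) (strict k 1+k≤1+n)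

size-induction : ∀ {n} (P : Subset n → Set) →
  (∀ S → (∀ S' → ∣ S' ∣ < ∣ S ∣ → P S') → P S) → ∀ S → P S
size-induction P step S = <-rec (λ k → ∀ S → ∣ S ∣ ≡ k → P S) go ∣ S ∣ S refl
  where
  go : ∀ k → (∀ {j} → j < k → ∀ S → ∣ S ∣ ≡ j → P S) → ∀ S → ∣ S ∣ ≡ k → P S
  go _ rec S refl = step S (λ S' smaller → rec smaller S' refl)

module Basics {n : ℕ} (G : Graph n) where

  adj-sym : ∀ {x y} → Adj G x y → Adj G y x
  adj-sym {x} {y} = subst T (Graph.sym G x y)

  adj-irrefl : ∀ {x} → ¬ Adj G x x
  adj-irrefl {x} = subst T (irrefl G x)

  adj? : ∀ x y → Dec (Adj G x y)
  adj? x y = T? (E G x y)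

  adj⇒≢ : ∀ {x y} → Adj G x y → x ≢ y
  adj⇒≢ xy refl = adj-irrefl xy

  _∈N[_] : Fin n → Fin n → Set
  y ∈N[ x ] = x ≡ y ⊎ Adj G x y

  _∈N[_]? : ∀ y x → Dec (y ∈N[ x ])
  y ∈N[ x ]? = (x ≟ᶠ y) ⊎-dec adj? x y

  ∈closedNbhd⁻ : ∀ {x y} → y ∈ closedNbhd G x → y ∈N[ x ]
  ∈closedNbhd⁻ {x} {y} y∈ with x ≟ᶠ y | trans (sym (lookup∘tabulate _ y)) ([]=⇒lookup y∈)
  ... | yes x≡y | _     = inj₁ x≡y
  ... | no _    | xy≡tt = inj₂ (subst T (sym xy≡tt) _)

  ∈closedNbhd⁺ : ∀ {x y} → y ∈N[ x ] → y ∈ closedNbhd G x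
  ∈closedNbhd⁺ {x} {y} y∈N = lookup⇒[]= y _ (trans (lookup∘tabulate _ y) (holds (x ≟ᶠ y) y∈N))
    where
    holds : (d : Dec (x ≡ y)) → y ∈N[ x ] → ⌊ d ⌋ ∨ E G x y ≡ true
    holds (yes _)   _           = refl
    holds (no x≢y)  (inj₁ x≡y)  = ⊥-elim (x≢y x≡y)
    holds (no _)    (inj₂ xy) with E G x y
    ... | true = refl

  ∈─N⁻ : ∀ {S x y} → y ∈ S ─ closedNbhd G x → y ∈ S × ¬ y ∈N[ x ]
  ∈─N⁻ {S} {x} y∈ = p─q⊆p S _ y∈ , λ y∈N → x∈p─q⇒x∉q S _ y∈ (∈closedNbhd⁺ y∈N)

  ∈─N⁺ : ∀ {S x y} → y ∈ S → ¬ y ∈N[ x ] → y ∈ S ─ closedNbhd G x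
  ∈─N⁺ y∈S y∉N = x∈p∧x∉q⇒x∈p─q y∈S (λ y∈ → y∉N (∈closedNbhd⁻ y∈))

  x∉S─N[x] : ∀ {S x} → x ∉ S ─ closedNbhd G x
  x∉S─N[x] x∈ = proj₂ (∈─N⁻ x∈) (inj₁ refl)

  ∉─N⇒∈N : ∀ {S x y} → y ∈ S → y ∉ S ─ closedNbhd G x → y ∈N[ x ]
  ∉─N⇒∈N {x = x} {y} y∈S y∉ with y ∈N[ x ]?
  ... | yes y∈N = y∈N
  ... | no y∉N  = ⊥-elim (y∉ (∈─N⁺ y∈S y∉N))

  Clique : Subset n → Set
  Clique Q = ∀ a b → a ∈ Q → b ∈ Q → a ≢ b → Adj G a b

  Simplicial : Subset n → Fin n → Set
  Simplicial S s = s ∈ S × (∀ a b → a ∈ S → b ∈ S → Adj G s a → Adj G s b → a ≢ b → Adj G a b)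

  simplicial-clique : ∀ {S s a b} → Simplicial S s → a ∈ S → b ∈ S →
    a ∈N[ s ] → b ∈N[ s ] → a ≢ b → Adj G a b
  simplicial-clique _          _   _   (inj₁ refl) (inj₁ refl) a≢b = ⊥-elim (a≢b refl)
  simplicial-clique _          _   _   (inj₁ refl) (inj₂ sb)   _   = sb
  simplicial-clique _          _   _   (inj₂ sa)   (inj₁ refl) _   = adj-sym sa
  simplicial-clique (_ , simp) a∈S b∈S (inj₂ sa)   (inj₂ sb)   a≢b = simp _ _ a∈S b∈S sa sb a≢b

  link-smaller : ∀ {S x} → x ∈ S → ∣ S ─ closedNbhd G x ∣ < ∣ S ∣
  link-smaller {S} x∈S = p⊂q⇒∣p∣<∣q∣ (p─q⊆p S _ , _ , x∈S , x∉S─N[x])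

module IndependentSets {n : ℕ} (G : Graph n) where

  open Basics G

  Addable : Subset n → Subset n → Fin n → Set
  Addable S J v = v ∈ S × v ∉ J × (∀ u → u ∈ J → ¬ Adj G u v)

  addable? : ∀ S J v → Dec (Addable S J v)
  addable? S J v = (v ∈? S) ×-dec ¬? (v ∈? J) ×-dec all? (λ u → (u ∈? J) →-dec ¬? (adj? u v))

  add-independent : ∀ {S J v} → Independent G S J → Addable S J v → Independent G S (J ∪ ⁅ v ⁆)
  add-independent {S} {J} {v} (J⊆S , indJ) (v∈S , _ , v⊥J) = ⊆S , ind
    where
    ⊆S : ∀ x → x ∈ J ∪ ⁅ v ⁆ → x ∈ S
    ⊆S x x∈ with x∈p∪⁅y⁆⁻ J x∈
    ... | inj₁ x∈J = J⊆S x x∈J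
    ... | inj₂ refl = v∈S
    ind : ∀ x y → x ∈ J ∪ ⁅ v ⁆ → y ∈ J ∪ ⁅ v ⁆ → ¬ Adj G x y
    ind x y x∈ y∈ with x∈p∪⁅y⁆⁻ J x∈ | x∈p∪⁅y⁆⁻ J y∈
    ... | inj₁ x∈J | inj₁ y∈J = indJ x y x∈J y∈J
    ... | inj₁ x∈J | inj₂ refl = v⊥J x x∈J
    ... | inj₂ refl | inj₁ y∈J = λ vy → v⊥J y y∈J (adj-sym vy)
    ... | inj₂ refl | inj₂ refl = adj-irrefl

  maximal-if-saturated : ∀ {S J} → Independent G S J → (∀ v → ¬ Addable S J v) → MaximalIndependent G S J
  maximal-if-saturated {S} {J} indJ saturated = indJ , dominated
    where
    dominated : ∀ v → v ∈ S → v ∉ J → Σ (Fin n) λ u → u ∈ J × Adj G u v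
    dominated v v∈S v∉J with any? (λ u → (u ∈? J) ×-dec adj? u v)
    ... | yes witness = witness
    ... | no none = ⊥-elim (saturated v (v∈S , v∉J , λ u u∈J uv → none (u , u∈J , uv)))

  -- Every independent set of G[S] extends to a maximal one (greedily; the
  -- room n - ∣J∣ left for new vertices bounds the number of steps).
  abstract
    extendToMaximal : ∀ S J → Independent G S J →
      ∃ λ M → MaximalIndependent G S M × (∀ x → x ∈ J → x ∈ M)
    extendToMaximal S J₀ ind₀ = grow n J₀ ind₀ (m≤n+m n ∣ J₀ ∣) (λ _ x∈ → x∈)
      where
      grow : ∀ room J → Independent G S J → n ≤ ∣ J ∣ + room → (∀ x → x ∈ J₀ → x ∈ J) →
        ∃ λ M → MaximalIndependent G S M × (∀ x → x ∈ J₀ → x ∈ M)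
      grow room J indJ bound J₀⊆J with any? (addable? S J)
      ... | no saturated = J , maximal-if-saturated indJ (λ v a → saturated (v , a)) , J₀⊆J
      ... | yes (v , a@(_ , v∉J , _)) with room
      ...   | zero = ⊥-elim (<-irrefl refl (begin-strict
                ∣ J ∣ + 0        ≤⟨ ≤-reflexive (+-identityʳ _) ⟩
                ∣ J ∣            <⟨ ≤-reflexive (sym (∣p∪⁅x⁆∣≡1+∣p∣ v J v∉J)) ⟩
                ∣ J ∪ ⁅ v ⁆ ∣    ≤⟨ ∣p∣≤n (J ∪ ⁅ v ⁆) ⟩
                n                ≤⟨ bound ⟩
                ∣ J ∣ + 0        ∎))
        where open ≤-Reasoning
      ...   | suc room' = grow room' (J ∪ ⁅ v ⁆) (add-independent indJ a) bound' (λ x x∈ → x∈p⇒x∈p∪⁅y⁆ v (J₀⊆J x x∈))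
        where
        bound' : n ≤ ∣ J ∪ ⁅ v ⁆ ∣ + room'
        bound' = subst (λ k → n ≤ k + room') (sym (∣p∪⁅x⁆∣≡1+∣p∣ v J v∉J)) (subst (n ≤_) (+-suc _ room') bound)

  well-covered-of : ∀ {S} → VertexDecomposable G S → WellCovered G S
  well-covered-of (vd-edgeless wc _)   = wc
  well-covered-of (vd-shed wc _ _ _ _) = wc

  maximal-link : ∀ {S s I} → s ∈ S → MaximalIndependent G (S ─ closedNbhd G s) I →
    MaximalIndependent G S (I ∪ ⁅ s ⁆)
  maximal-link {S} {s} {I} s∈S ((I⊆ , indI) , domI) =
    add-independent (I⊆S , indI) (s∈S , s∉I , s⊥I) , dominated
    where
    I⊆S : ∀ x → x ∈ I → x ∈ S
    I⊆S x x∈I = proj₁ (∈─N⁻ (I⊆ x x∈I))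
    s∉I : s ∉ I
    s∉I s∈I = x∉S─N[x] (I⊆ s s∈I)
    s⊥I : ∀ u → u ∈ I → ¬ Adj G u s
    s⊥I u u∈I us = proj₂ (∈─N⁻ (I⊆ u u∈I)) (inj₂ (adj-sym us))
    dominated : ∀ v → v ∈ S → v ∉ I ∪ ⁅ s ⁆ → Σ (Fin n) λ u → u ∈ I ∪ ⁅ s ⁆ × Adj G u v
    dominated v v∈S v∉ with v ∈N[ s ]?
    ... | yes (inj₁ refl) = ⊥-elim (v∉ (y∈p∪⁅y⁆ s))
    ... | yes (inj₂ sv) = s , y∈p∪⁅y⁆ s , sv
    ... | no v∉N with domI v (∈─N⁺ v∈S v∉N) (λ v∈I → v∉ (x∈p⇒x∈p∪⁅y⁆ s v∈I))
    ...   | u , u∈I , uv = u , x∈p⇒x∈p∪⁅y⁆ s u∈I , uv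

  wellCovered-link : ∀ {S s} → WellCovered G S → s ∈ S → WellCovered G (S ─ closedNbhd G s)
  wellCovered-link {S} {s} wc s∈S I J maxI maxJ = suc-injective (begin
    suc ∣ I ∣        ≡⟨ ∣p∪⁅x⁆∣≡1+∣p∣ s I (s∉ maxI) ⟨
    ∣ I ∪ ⁅ s ⁆ ∣    ≡⟨ wc _ _ (maximal-link s∈S maxI) (maximal-link s∈S maxJ) ⟩
    ∣ J ∪ ⁅ s ⁆ ∣    ≡⟨ ∣p∪⁅x⁆∣≡1+∣p∣ s J (s∉ maxJ) ⟩
    suc ∣ J ∣        ∎)
    where
    open ≡-Reasoning
    s∉ : ∀ {K} → MaximalIndependent G (S ─ closedNbhd G s) K → s ∉ K
    s∉ ((K⊆ , _) , _) s∈K = x∉S─N[x] (K⊆ s s∈K)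

  -- If s is simplicial and x a neighbour of s, every maximal independent set
  -- of G[S] ∖ x is maximal in G[S]: x is dominated by s or by the vertex
  -- dominating s, which is adjacent to x because N[s] is a clique.
  maximal-del : ∀ {S s x I} → Simplicial S s → x ∈ S → Adj G s x →
    MaximalIndependent G (S - x) I → MaximalIndependent G S I
  maximal-del {S} {s} {x} {I} simp@(s∈S , _) x∈S sx ((I⊆ , indI) , domI) =
    ((λ y y∈I → p─q⊆p S _ (I⊆ y y∈I)) , indI) , dominated
    where
    dominated : ∀ v → v ∈ S → v ∉ I → Σ (Fin n) λ u → u ∈ I × Adj G u v
    dominated v v∈S v∉I with v ≟ᶠ x
    ... | no v≢x = domI v (x∈p∧x≢y⇒x∈p-y v∈S v≢x) v∉I
    ... | yes refl with s ∈? I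
    ...   | yes s∈I = s , s∈I , sx
    ...   | no s∉I with domI s (x∈p∧x≢y⇒x∈p-y s∈S (adj⇒≢ sx)) s∉I
    ...     | u , u∈I , us = u , u∈I ,
                simplicial-clique simp (p─q⊆p S _ (I⊆ u u∈I)) v∈S (inj₂ (adj-sym us)) (inj₂ sx)
                  (x∈p-y⇒x≢y S (I⊆ u u∈I))

  wellCovered-del : ∀ {S s x} → WellCovered G S → Simplicial S s → x ∈ S → Adj G s x →
    WellCovered G (S - x)
  wellCovered-del wc simp x∈S sx I J maxI maxJ =
    wc I J (maximal-del simp x∈S sx maxI) (maximal-del simp x∈S sx maxJ)

  isolated-del≡link : ∀ S v → (∀ w → w ∈ S → ¬ Adj G v w) → S - v ≡ S ─ closedNbhd G v
  isolated-del≡link S v isolated = ⊆-antisym del⊆link link⊆del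
    where
    del⊆link : ∀ {y} → y ∈ S - v → y ∈ S ─ closedNbhd G v
    del⊆link {y} y∈ = ∈─N⁺ y∈S [ (λ v≡y → x∈p-y⇒x≢y S y∈ (sym v≡y)) , isolated y y∈S ]
      where y∈S = p─q⊆p S _ y∈
    link⊆del : ∀ {y} → y ∈ S ─ closedNbhd G v → y ∈ S - v
    link⊆del y∈ with ∈─N⁻ y∈
    ... | y∈S , y∉N = x∈p∧x≢y⇒x∈p-y y∈S (λ y≡v → y∉N (inj₁ (sym y≡v)))

  -- An independent set of G[S] meets the clique N[s] of a simplicial vertex s
  -- at most once, so it has at most one vertex outside G[S] ∖ N[s].
  independent-outside-link : ∀ {S s I} → Simplicial S s → Independent G S I →
    ∣ I ∣ ≤ suc ∣ I ∩ (S ─ closedNbhd G s) ∣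
  independent-outside-link {S} {s} {I} simp (I⊆S , indI)
    with any? (λ y → (y ∈? I) ×-dec ¬? (y ∈? (S ─ closedNbhd G s)))
  ... | yes (y , y∈I , y∉L) = ≤-trans (p⊆q⇒∣p∣≤∣q∣ I⊆) (∣p∪⁅x⁆∣≤1+∣p∣ y (I ∩ (S ─ closedNbhd G s)))
    where
    I⊆ : I ⊆ I ∩ (S ─ closedNbhd G s) ∪ ⁅ y ⁆
    I⊆ {x} x∈I with x ∈? (S ─ closedNbhd G s) | x ≟ᶠ y
    ... | yes x∈L | _ = x∈p⇒x∈p∪⁅y⁆ y (x∈p∩q⁺ (x∈I , x∈L))
    ... | no _ | yes refl = y∈p∪⁅y⁆ y
    ... | no x∉L | no x≢y = ⊥-elim (indI x y x∈I y∈I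
            (simplicial-clique simp (I⊆S x x∈I) (I⊆S y y∈I)
              (∉─N⇒∈N (I⊆S x x∈I) x∉L) (∉─N⇒∈N (I⊆S y y∈I) y∉L) x≢y))
  ... | no allInside = ≤-trans (p⊆q⇒∣p∣≤∣q∣ I⊆) (n≤1+n _)
    where
    I⊆ : I ⊆ I ∩ (S ─ closedNbhd G s)
    I⊆ {x} x∈I with x ∈? (S ─ closedNbhd G s)
    ... | yes x∈L = x∈p∩q⁺ (x∈I , x∈L)
    ... | no x∉L  = ⊥-elim (allInside (x , x∈I , x∉L))

module Detours {n : ℕ} (G : Graph n) (chordal : Chordal G) where

  open Basics G

  -- Closing it up through r gives a cycle of length at least four, so in a
  -- chordal graph detours cannot exist; this is the only use of chordality.
  record Detour (r : Fin n) (p : ℕ → Fin n) (k : ℕ) : Set where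
    field
      start-adj     : Adj G (p 0) r
      end-adj       : Adj G (p k) r
      ends-distinct : p 0 ≢ p k
      ends-nonadj   : ¬ Adj G (p 0) (p k)
      inner-avoid   : ∀ i → 0 < i → i < k → ¬ p i ∈N[ r ]
      steps         : ∀ i → i < k → Adj G (p i) (p (suc i))

  Defect : (ℕ → Fin n) → ℕ → ℕ → Set
  Defect p i j = p i ≡ p j ⊎ (j ≢ suc i × Adj G (p i) (p j))

  defect? : ∀ p i j → Dec (Defect p i j)
  defect? p i j = (p i ≟ᶠ p j) ⊎-dec (¬? (j ≟ suc i) ×-dec adj? (p i) (p j))

  skip : (ℕ → Fin n) → ℕ → ℕ → ℕ → Fin n
  skip p i d l with l ≤? i
  ... | yes _ = p l
  ... | no _  = p (l + d)

  skip-≤ : ∀ p i d l → l ≤ i → skip p i d l ≡ p l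
  skip-≤ p i d l l≤i with l ≤? i
  ... | yes _   = refl
  ... | no l≰i  = ⊥-elim (l≰i l≤i)

  skip-> : ∀ p i d l → i < l → skip p i d l ≡ p (l + d)
  skip-> p i d l i<l with l ≤? i
  ... | yes l≤i = ⊥-elim (<⇒≱ i<l l≤i)
  ... | no _    = refl

  adj-cong : ∀ {x y x' y'} → x ≡ x' → y ≡ y' → Adj G x y → Adj G x' y'
  adj-cong refl refl xy = xy

  -- Cutting out a segment keeps a detour a detour, provided the cut is
  -- bridged by an edge (or, when the cut reaches the end, by a repeat).
  skip-detour : ∀ {r p k k' d i} → Detour r p k → k ≡ k' + d → i ≤ k' →
    (i < k' → Adj G (p i) (p (suc i + d))) → (i ≡ k' → p i ≡ p k) →
    Detour r (skip p i d) k'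
  skip-detour {r} {p} {k' = k'} {d} {i} w refl i≤k' bridge end-repeat = record
    { start-adj     = subst (λ x → Adj G x r) (sym q₀) start-adj
    ; end-adj       = subst (λ x → Adj G x r) (sym qₖ) end-adj
    ; ends-distinct = λ e → ends-distinct (trans (sym q₀) (trans e qₖ))
    ; ends-nonadj   = λ a → ends-nonadj (adj-cong q₀ qₖ a)
    ; inner-avoid   = inner
    ; steps         = step
    }
    where
    open Detour w
    q : ℕ → Fin n
    q = skip p i d
    q₀ : q 0 ≡ p 0
    q₀ = skip-≤ p i d 0 z≤n
    qₖ : q k' ≡ p (k' + d)
    qₖ with m≤n⇒m<n∨m≡n i≤k'
    ... | inj₁ i<k' = skip-> p i d k' i<k'
    ... | inj₂ refl = trans (skip-≤ p i d i ≤-refl) (end-repeat refl)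
    kept : ∀ {l} → l < k' → l < k' + d
    kept l<k' = <-≤-trans l<k' (m≤m+n k' d)
    shifted : ∀ {l} → l < k' → l + d < k' + d
    shifted = +-monoˡ-< d
    inner : ∀ l → 0 < l → l < k' → ¬ q l ∈N[ r ]
    inner l 0<l l<k' with l ≤? i
    ... | yes _ = inner-avoid l 0<l (kept l<k')
    ... | no _  = inner-avoid (l + d) (<-≤-trans 0<l (m≤m+n l d)) (shifted l<k')
    step : ∀ l → l < k' → Adj G (q l) (q (suc l))
    step l l<k' with <-cmp l i
    ... | tri< l<i _ _ = adj-cong (sym (skip-≤ p i d l (<⇒≤ l<i))) (sym (skip-≤ p i d (suc l) l<i))
                           (steps l (kept l<k'))
    ... | tri≈ _ refl _ = adj-cong (sym (skip-≤ p i d l ≤-refl)) (sym (skip-> p i d (suc l) (n<1+n l)))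
                           (bridge l<k')
    ... | tri> _ _ i<l = adj-cong (sym (skip-> p i d l i<l)) (sym (skip-> p i d (suc l) (m<n⇒m<1+n i<l)))
                           (steps (l + d) (shifted l<k'))

  ShorterDetour : Fin n → ℕ → Set
  ShorterDetour r k = ∃ λ k' → k' < k × ∃ λ q → Detour r q k'

  shorter : ∀ {k k' d} → k ≡ k' + suc d → k' < k
  shorter {k' = k'} refl = m<m+n k' z<s

  repeat-length : ∀ i d e → suc (i + d) + e ≡ (i + e) + suc d
  repeat-length = solve-∀

  chord-length : ∀ i d e → suc (i + suc d) + e ≡ suc (i + e) + suc d
  chord-length = solve-∀

  -- A defect yields a shorter detour: a repeat p i = p j is removed by cutting
  -- out positions i+1, …, j, a chord p i — p j by cutting out i+1, …, j-1.
  defect-shortcut : ∀ {r p k i j} → Detour r p k → i < j → j ≤ k → Defect p i j → ShorterDetour r k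
  defect-shortcut {i = i} {j} w i<j j≤k defect with m≤n⇒∃[o]m+o≡n i<j | m≤n⇒∃[o]m+o≡n j≤k
  defect-shortcut {p = p} {i = i} w _ _ (inj₁ pᵢ≡pⱼ) | d , refl | zero , refl =
    i , shorter len , _ , skip-detour w len ≤-refl (λ i<i → ⊥-elim (<-irrefl refl i<i))
                            (λ _ → trans pᵢ≡pⱼ (cong p (sym (+-identityʳ _))))
    where
    len : suc (i + d) + 0 ≡ i + suc d
    len = trans (repeat-length i d 0) (cong (_+ suc d) (+-identityʳ i))
  defect-shortcut {p = p} {i = i} w _ _ (inj₁ pᵢ≡pⱼ) | d , refl | suc e , refl =
    i + suc e , shorter (repeat-length i d (suc e)) ,
    _ , skip-detour w (repeat-length i d (suc e)) (m≤m+n i (suc e)) bridge (λ i≡ → ⊥-elim (m+1+n≢m i (sym i≡)))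
    where
    bridge : i < i + suc e → Adj G (p i) (p (suc i + suc d))
    bridge _ = adj-cong (sym pᵢ≡pⱼ) (cong (λ l → p (suc l)) (sym (+-suc i d)))
                 (Detour.steps w (suc (i + d)) (m<m+n _ z<s))
  defect-shortcut w _ _ (inj₂ (j≢1+i , _)) | zero , refl | _ = ⊥-elim (j≢1+i (+-identityʳ _))
  defect-shortcut {i = i} w _ _ (inj₂ (_ , chord)) | suc d , refl | e , refl =
    suc (i + e) , shorter (chord-length i d e) ,
    _ , skip-detour w (chord-length i d e) (≤-trans (m≤m+n i e) (n≤1+n _)) (λ _ → chord)
          (λ i≡ → ⊥-elim (m≢1+m+n i i≡))

  -- A detour of length k = m + 2 without defects, closed up through r, is an
  -- induced cycle r, p 0, …, p k of length k + 2 = (m + 1) + 3.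
  module DefectFree {r p m} (w : Detour r p (suc (suc m)))
    (clean : ∀ i j → i < j → j ≤ suc (suc m) → ¬ Defect p i j) where

    open Detour w

    k : ℕ
    k = suc (suc m)

    len : ℕ
    len = suc (suc k)

    at : ℕ → Fin n
    at zero    = r
    at (suc l) = p l

    on-walk : ∀ {l} → suc l < len → l ≤ k
    on-walk 1+l<len = ≤-pred (≤-pred 1+l<len)

    p-injective : ∀ {l l'} → l ≤ k → l' ≤ k → p l ≡ p l' → l ≡ l'
    p-injective {l} {l'} l≤k l'≤k eq with <-cmp l l'
    ... | tri< l<l' _ _ = ⊥-elim (clean l l' l<l' l'≤k (inj₁ eq))
    ... | tri≈ _ l≡l' _ = l≡l'
    ... | tri> _ _ l'<l = ⊥-elim (clean l' l l'<l l≤k (inj₁ (sym eq)))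

    p-adj : ∀ {l l'} → l' ≤ k → l < l' → Adj G (p l) (p l') → l' ≡ suc l
    p-adj {l} {l'} l'≤k l<l' pp with l' ≟ suc l
    ... | yes l'≡1+l = l'≡1+l
    ... | no l'≢1+l  = ⊥-elim (clean l l' l<l' l'≤k (inj₂ (l'≢1+l , pp)))

    position : ∀ {l} → l ≤ k → l ≡ 0 ⊎ (0 < l × l < k) ⊎ l ≡ k
    position {zero} _ = inj₁ refl
    position {suc l} 1+l≤k with m≤n⇒m<n∨m≡n 1+l≤k
    ... | inj₁ 1+l<k = inj₂ (inj₁ (z<s , 1+l<k))
    ... | inj₂ 1+l≡k = inj₂ (inj₂ 1+l≡k)

    p≢r : ∀ {l} → l ≤ k → p l ≢ r
    p≢r l≤k with position l≤k
    ... | inj₁ refl = adj⇒≢ start-adj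
    ... | inj₂ (inj₁ (0<l , l<k)) = λ e → inner-avoid _ 0<l l<k (inj₁ (sym e))
    ... | inj₂ (inj₂ refl) = adj⇒≢ end-adj

    p-adj-r : ∀ {l} → l ≤ k → Adj G (p l) r → l ≡ 0 ⊎ l ≡ k
    p-adj-r l≤k pr with position l≤k
    ... | inj₁ l≡0 = inj₁ l≡0
    ... | inj₂ (inj₁ (0<l , l<k)) = ⊥-elim (inner-avoid _ 0<l l<k (inj₂ (adj-sym pr)))
    ... | inj₂ (inj₂ l≡k) = inj₂ l≡k

    at-injective : ∀ a b → a < len → b < len → at a ≡ at b → a ≡ b
    at-injective zero    zero    _ _ _ = refl
    at-injective zero    (suc b) _ b<len r≡ = ⊥-elim (p≢r (on-walk b<len) (sym r≡))
    at-injective (suc a) zero    a<len _ ≡r = ⊥-elim (p≢r (on-walk a<len) ≡r)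
    at-injective (suc a) (suc b) a<len b<len eq =
      cong suc (p-injective (on-walk a<len) (on-walk b<len) eq)

    next : ∀ a → suc a < len → (a + 1) % len ≡ suc a
    next a 1+a<len = trans (cong (_% len) (+-comm a 1)) (m<n⇒m%n≡m 1+a<len)

    wrap : (suc k + 1) % len ≡ 0
    wrap = trans (cong (_% len) (+-comm (suc k) 1)) (n%n≡0 len)

    Consecutive : ℕ → ℕ → Set
    Consecutive a b = b ≡ (a + 1) % len ⊎ a ≡ (b + 1) % len

    adj⇒consecutive : ∀ a b → a < len → b < len → Adj G (at a) (at b) → Consecutive a b
    adj⇒consecutive zero zero _ _ rr = ⊥-elim (adj-irrefl rr)
    adj⇒consecutive zero (suc l) _ b<len rp with p-adj-r (on-walk b<len) (adj-sym rp)
    ... | inj₁ refl = inj₁ (sym (next 0 (s≤s (s≤s z≤n))))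
    ... | inj₂ refl = inj₂ (sym wrap)
    adj⇒consecutive (suc l) zero a<len _ pr with p-adj-r (on-walk a<len) pr
    ... | inj₁ refl = inj₂ (sym (next 0 (s≤s (s≤s z≤n))))
    ... | inj₂ refl = inj₁ (sym wrap)
    adj⇒consecutive (suc l) (suc l') a<len b<len pp with <-cmp l l'
    ... | tri< l<l' _ _ = inj₁ (trans (cong suc l'≡1+l) (sym (next (suc l) (s≤s (s≤s (subst (_≤ k) l'≡1+l l'≤k))))))
      where
      l'≤k = on-walk b<len
      l'≡1+l = p-adj l'≤k l<l' pp
    ... | tri≈ _ refl _ = ⊥-elim (adj-irrefl pp)
    ... | tri> _ _ l'<l = inj₂ (trans (cong suc l≡1+l') (sym (next (suc l') (s≤s (s≤s (subst (_≤ k) l≡1+l' l≤k))))))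
      where
      l≤k = on-walk a<len
      l≡1+l' = p-adj l≤k l'<l (adj-sym pp)

    consecutive⇒adj : ∀ a b → a < len → b ≡ (a + 1) % len → Adj G (at a) (at b)
    consecutive⇒adj a b a<len b≡ with m<1+n⇒m<n∨m≡n a<len
    ... | inj₁ a<1+k = subst (λ c → Adj G (at a) (at c)) (sym (trans b≡ (next a (s≤s a<1+k)))) (walk-step a (s≤s a<1+k))
      where
      walk-step : ∀ a → suc a < len → Adj G (at a) (at (suc a))
      walk-step zero    _       = adj-sym start-adj
      walk-step (suc l) 2+l<len = steps l (≤-pred (≤-pred 2+l<len))
    ... | inj₂ refl = subst (λ c → Adj G (p k) (at c)) (sym (trans b≡ wrap)) end-adj

    bounded : ∀ (f : Fin (suc m + 3)) → toℕ f < len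
    bounded f = subst (toℕ f <_) (+-comm (suc m) 3) (toℕ<n f)

    induced-cycle : IsInducedCycle G (suc m) (λ f → at (toℕ f))
    induced-cycle =
      (λ {f} {g} eq → toℕ-injective (at-injective (toℕ f) (toℕ g) (bounded f) (bounded g) eq)) ,
      (λ { f g (inj₁ e) → consecutive⇒adj (toℕ f) (toℕ g) (bounded f) e
         ; f g (inj₂ e) → adj-sym (consecutive⇒adj (toℕ g) (toℕ f) (bounded g) e) }) ,
      (λ f g → adj⇒consecutive (toℕ f) (toℕ g) (bounded f) (bounded g))

  -- Chordal graphs have no detours: a shortest detour would be defect-free,
  -- hence an induced cycle of length at least four.
  no-detour : ∀ k {r p} → ¬ Detour r p k
  no-detour = <-rec (λ k → ∀ {r p} → ¬ Detour r p k) noDetourOfLength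
    where
    cycle-too-long : ∀ m → suc m + 3 ≢ 3
    cycle-too-long m e with trans (+-comm 3 (suc m)) e
    ... | ()
    noDetourOfLength : ∀ k → (∀ {j} → j < k → ∀ {r p} → ¬ Detour r p j) → ∀ {r p} → ¬ Detour r p k
    noDetourOfLength zero _ w = Detour.ends-distinct w refl
    noDetourOfLength (suc zero) _ w = Detour.ends-nonadj w (Detour.steps w 0 z<s)
    noDetourOfLength (suc (suc m)) shorterImpossible {p = p} w
      with anyUpTo? (λ j → anyUpTo? (λ i → defect? p i j) j) (suc (suc (suc m)))
    ... | yes (j , j<1+k , i , i<j , defect) =
      let (_ , k'<k , _ , w') = defect-shortcut w i<j (≤-pred j<1+k) defect in shorterImpossible k'<k w'
    ... | no none = cycle-too-long m (chordal (suc m) _ (DefectFree.induced-cycle w clean))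
      where
      clean : ∀ i j → i < j → j ≤ suc (suc m) → ¬ Defect _ i j
      clean i j i<j j≤k defect = none (j , s≤s j≤k , i , i<j , defect)

  no-square : ∀ {a b c d} → Adj G a b → Adj G b c → Adj G c d → Adj G d a →
    ¬ Adj G a c → ¬ Adj G b d → b ≢ d → a ≢ c → ⊥
  no-square {a} {b} {c} {d} ab bc cd da ¬ac ¬bd b≢d a≢c = no-detour 2 square
    where
    p : ℕ → Fin n
    p 0 = b
    p 1 = c
    p _ = d
    square : Detour a p 2
    square = record
      { start-adj     = adj-sym ab
      ; end-adj       = da
      ; ends-distinct = b≢d
      ; ends-nonadj   = ¬bd
      ; inner-avoid   = λ { 1 _ _ → [ a≢c , ¬ac ] ; (suc (suc _)) _ (s≤s (s≤s ())) }
      ; steps         = λ { 0 _ → bc ; 1 _ → cd ; (suc (suc _)) (s≤s (s≤s ())) }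
      }

module Walks {n : ℕ} (G : Graph n) where

  open Basics G

  data Walk (U : Subset n) : Fin n → Fin n → Set where
    stay : ∀ {a} → a ∈ U → Walk U a a
    step : ∀ {a b c} → a ∈ U → Adj G a b → Walk U b c → Walk U a c

  module _ {U : Subset n} where

    length : ∀ {a b} → Walk U a b → ℕ
    length (stay _)     = 0
    length (step _ _ w) = suc (length w)

    end∈ : ∀ {a b} → Walk U a b → b ∈ U
    end∈ (stay b∈)     = b∈
    end∈ (step _ _ w) = end∈ w

    _++ʷ_ : ∀ {a b c} → Walk U a b → Walk U b c → Walk U a c
    stay _       ++ʷ w' = w'
    step a∈ ab w ++ʷ w' = step a∈ ab (w ++ʷ w')

    extend : ∀ {a b c} → Walk U a b → Adj G b c → c ∈ U → Walk U a c
    extend w bc c∈ = w ++ʷ step (end∈ w) bc (stay c∈)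

    reverse : ∀ {a b} → Walk U a b → Walk U b a
    reverse (stay a∈)     = stay a∈
    reverse (step a∈ ab w) = extend (reverse w) (adj-sym ab) a∈

    trace : ∀ {a b} → Walk U a b → Fin n → ℕ → Fin n
    trace {a} (stay _)     z zero    = a
    trace     (stay _)     z (suc _) = z
    trace {a} (step _ _ w) z zero    = a
    trace     (step _ _ w) z (suc i) = trace w z i

    trace-start : ∀ {a b} (w : Walk U a b) z → trace w z 0 ≡ a
    trace-start (stay _)     z = refl
    trace-start (step _ _ _) z = refl

    trace-after : ∀ {a b} (w : Walk U a b) z → trace w z (suc (length w)) ≡ z
    trace-after (stay _)     z = refl
    trace-after (step _ _ w) z = trace-after w z

    trace-inside : ∀ {a b} (w : Walk U a b) z i → i ≤ length w → trace w z i ∈ U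
    trace-inside (stay a∈)     z zero    _       = a∈
    trace-inside (step a∈ _ w) z zero    _       = a∈
    trace-inside (step _ _ w)  z (suc i) (s≤s i≤) = trace-inside w z i i≤

    trace-steps : ∀ {a b z} (w : Walk U a b) → Adj G b z →
      ∀ i → i ≤ length w → Adj G (trace w z i) (trace w z (suc i))
    trace-steps (stay _)      bz zero    _        = bz
    trace-steps (step _ ab w) bz zero    _        = subst (Adj G _) (sym (trace-start w _)) ab
    trace-steps (step _ _ w)  bz (suc i) (s≤s i≤) = trace-steps w bz i i≤

  -- The connected component of u in G[U].  reach k holds the vertices joined
  -- to u by a walk of at most k steps; this chain stops growing at some radius.
  module Component (U : Subset n) (u : Fin n) (u∈U : u ∈ U) where

    Frontier : Subset n → Fin n → Set
    Frontier R x = x ∈ U × ∃ λ c → c ∈ R × Adj G c x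

    frontier? : ∀ R x → Dec (Frontier R x)
    frontier? R x = (x ∈? U) ×-dec any? (λ c → (c ∈? R) ×-dec adj? c x)

    reach : ℕ → Subset n
    reach zero    = ⁅ u ⁆
    reach (suc k) = reach k ∪ subsetOf (frontier? (reach k))

    reach-walk : ∀ k {x} → x ∈ reach k → Walk U u x
    reach-walk zero    x∈ with x∈⁅y⁆⇒x≡y u x∈
    ... | refl = stay u∈U
    reach-walk (suc k) x∈ with x∈p∪q⁻ (reach k) _ x∈
    ... | inj₁ x∈R = reach-walk k x∈R
    ... | inj₂ x∈F with ∈subsetOf⁻ (frontier? (reach k)) x∈F
    ...   | x∈U , c , c∈R , cx = extend (reach-walk k c∈R) cx x∈U

    stable : ∃ λ k → reach (suc k) ⊆ reach k
    stable = chain-stabilises reach (λ k → p⊆p∪q _)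

    radius : ℕ
    radius = proj₁ stable

    C : Subset n
    C = reach radius

    u∈C : u ∈ C
    u∈C = u∈R radius
      where
      u∈R : ∀ k → u ∈ reach k
      u∈R zero    = x∈⁅x⁆ u
      u∈R (suc k) = x∈p∪q⁺ (inj₁ (u∈R k))

    C⊆U : ∀ {c} → c ∈ C → c ∈ U
    C⊆U c∈ = end∈ (reach-walk radius c∈)

    C-closed : ∀ {c x} → c ∈ C → x ∈ U → Adj G c x → x ∈ C
    C-closed c∈ x∈U cx = proj₂ stable (x∈p∪q⁺ (inj₂ (∈subsetOf⁺ (frontier? C) (x∈U , _ , c∈ , cx))))

    C-connected : ∀ {c c'} → c ∈ C → c' ∈ C → Walk U c c'
    C-connected c∈ c'∈ = reverse (reach-walk radius c∈) ++ʷ reach-walk radius c'∈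

module Dirac {n : ℕ} (G : Graph n) (chordal : Chordal G) where

  open Basics G
  open Walks G
  open Detours G chordal

  -- If Q is a clique and S ⊄ Q, then G[S] has a simplicial vertex outside Q.
  -- (With Q empty this is Dirac's theorem; the clique makes the induction work.)
  SimplicialOutside : Subset n → Set
  SimplicialOutside S = ∀ Q → Clique Q → (∃ λ u → u ∈ S × u ∉ Q) → ∃ λ s → Simplicial S s × s ∉ Q

  Universal : Subset n → Fin n → Set
  Universal S q = ∀ v → v ∈ S → v ∈N[ q ]

  simplicial-del-universal : ∀ {S q s} → Universal S q → Simplicial (S - q) s → Simplicial S s
  simplicial-del-universal {S} {q} {s} universal (s∈ , simp) = p─q⊆p S _ s∈ , simp'
    where
    adj-q : ∀ {v} → v ∈ S → v ≢ q → Adj G q v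
    adj-q v∈S v≢q with universal _ v∈S
    ... | inj₁ q≡v = ⊥-elim (v≢q (sym q≡v))
    ... | inj₂ qv  = qv
    simp' : ∀ a b → a ∈ S → b ∈ S → Adj G s a → Adj G s b → a ≢ b → Adj G a b
    simp' a b a∈S b∈S sa sb a≢b with a ≟ᶠ q | b ≟ᶠ q
    ... | yes refl | yes refl = ⊥-elim (a≢b refl)
    ... | yes refl | no b≢q   = adj-q b∈S b≢q
    ... | no a≢q   | yes refl = adj-sym (adj-q a∈S a≢q)
    ... | no a≢q   | no b≢q   = simp a b (x∈p∧x≢y⇒x∈p-y a∈S a≢q) (x∈p∧x≢y⇒x∈p-y b∈S b≢q) sa sb a≢b

  -- The
  -- vertices outside C with a neighbour in C form a clique B ⊆ N(r): two
  -- non-adjacent ones would be the ends of a detour around r through C.  A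
  -- simplicial vertex of the smaller graph G[C ∪ B] outside B lies in C; all its
  -- neighbours lie in C ∪ B, so it is simplicial in G[S], and it is not in Q.
  module BeyondNeighbourhood (S Q : Subset n) (r u : Fin n) (r∈S : r ∈ S) (u∈S : u ∈ S)
    (u∉N[r] : ¬ u ∈N[ r ]) (Q-near : ∀ q → q ∈ S → q ∈ Q → q ∈N[ r ]) where

    U : Subset n
    U = S ─ closedNbhd G r

    open Component U u (∈─N⁺ u∈S u∉N[r])

    C-far : ∀ {c} → c ∈ C → ¬ c ∈N[ r ]
    C-far c∈C = proj₂ (∈─N⁻ (C⊆U c∈C))

    Boundary : Fin n → Set
    Boundary z = z ∈ S × z ∉ C × ∃ λ c → c ∈ C × Adj G c z

    boundary? : ∀ z → Dec (Boundary z)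
    boundary? z = (z ∈? S) ×-dec ¬? (z ∈? C) ×-dec any? (λ c → (c ∈? C) ×-dec adj? c z)

    B : Subset n
    B = subsetOf boundary?

    boundary-adj : ∀ {z} → Boundary z → Adj G r z
    boundary-adj {z} (z∈S , z∉C , c , c∈C , cz) with z ∈N[ r ]?
    ... | yes (inj₁ refl) = ⊥-elim (C-far c∈C (inj₂ (adj-sym cz)))
    ... | yes (inj₂ rz)   = rz
    ... | no z∉N          = ⊥-elim (z∉C (C-closed c∈C (∈─N⁺ z∈S z∉N) cz))

    -- z₁, c₁, …, c₂, z₂ through C would be a detour around r.
    boundary-clique : Clique B
    boundary-clique z₁ z₂ z₁∈B z₂∈B z₁≢z₂ with adj? z₁ z₂
    ... | yes z₁z₂ = z₁z₂
    ... | no ¬z₁z₂ = ⊥-elim (no-detour _ detour)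
      where
      b₁ = ∈subsetOf⁻ boundary? z₁∈B
      b₂ = ∈subsetOf⁻ boundary? z₂∈B
      c₁∈C = proj₁ (proj₂ (proj₂ (proj₂ b₁)))
      c₂∈C = proj₁ (proj₂ (proj₂ (proj₂ b₂)))
      w = C-connected c₁∈C c₂∈C
      p : ℕ → Fin n
      p zero    = z₁
      p (suc i) = trace w z₂ i
      p-end : p (suc (suc (length w))) ≡ z₂
      p-end = trace-after w z₂
      inner : ∀ i → 0 < i → i < suc (suc (length w)) → ¬ p i ∈N[ r ]
      inner (suc i) _ i<  = proj₂ (∈─N⁻ (trace-inside w z₂ i (≤-pred (≤-pred i<))))
      steps : ∀ i → i < suc (suc (length w)) → Adj G (p i) (p (suc i))
      steps zero    _  = subst (Adj G z₁) (sym (trace-start w z₂)) (adj-sym (proj₂ (proj₂ (proj₂ (proj₂ b₁)))))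
      steps (suc i) i< = trace-steps w (proj₂ (proj₂ (proj₂ (proj₂ b₂)))) i (≤-pred (≤-pred i<))
      detour : Detour r p (suc (suc (length w)))
      detour = record
        { start-adj     = adj-sym (boundary-adj b₁)
        ; end-adj       = subst (λ x → Adj G x r) (sym p-end) (adj-sym (boundary-adj b₂))
        ; ends-distinct = λ e → z₁≢z₂ (trans e p-end)
        ; ends-nonadj   = λ a → ¬z₁z₂ (subst (Adj G z₁) p-end a)
        ; inner-avoid   = inner
        ; steps         = steps
        }

    C∪B⊆S : C ∪ B ⊆ S
    C∪B⊆S x∈ with x∈p∪q⁻ C B x∈
    ... | inj₁ x∈C = p─q⊆p S _ (C⊆U x∈C)
    ... | inj₂ x∈B = proj₁ (∈subsetOf⁻ boundary? x∈B)

    smaller : ∣ C ∪ B ∣ < ∣ S ∣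
    smaller = p⊂q⇒∣p∣<∣q∣ (C∪B⊆S , r , r∈S , r∉)
      where
      r∉ : r ∉ C ∪ B
      r∉ r∈ with x∈p∪q⁻ C B r∈
      ... | inj₁ r∈C = C-far r∈C (inj₁ refl)
      ... | inj₂ r∈B = adj-irrefl (boundary-adj (∈subsetOf⁻ boundary? r∈B))

    u-outside-B : ∃ λ v → v ∈ C ∪ B × v ∉ B
    u-outside-B = u , x∈p∪q⁺ (inj₁ u∈C) , λ u∈B → proj₁ (proj₂ (∈subsetOf⁻ boundary? u∈B)) u∈C

    lift : (∃ λ s → Simplicial (C ∪ B) s × s ∉ B) → ∃ λ s → Simplicial S s × s ∉ Q
    lift (s , (s∈ , simp) , s∉B) = s , (C∪B⊆S s∈ , simp') , λ s∈Q → C-far s∈C (Q-near s (C∪B⊆S s∈) s∈Q)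
      where
      s∈C : s ∈ C
      s∈C with x∈p∪q⁻ C B s∈
      ... | inj₁ s∈C = s∈C
      ... | inj₂ s∈B = ⊥-elim (s∉B s∈B)
      near : ∀ {a} → a ∈ S → Adj G s a → a ∈ C ∪ B
      near {a} a∈S sa with a ∈? C
      ... | yes a∈C = x∈p∪q⁺ (inj₁ a∈C)
      ... | no a∉C  = x∈p∪q⁺ (inj₂ (∈subsetOf⁺ boundary? (a∈S , a∉C , s , s∈C , sa)))
      simp' : ∀ a b → a ∈ S → b ∈ S → Adj G s a → Adj G s b → a ≢ b → Adj G a b
      simp' a b a∈S b∈S sa sb = simp a b (near a∈S sa) (near b∈S sb) sa sb

    result : SimplicialOutside (C ∪ B) → ∃ λ s → Simplicial S s × s ∉ Q
    result ih = lift (ih B boundary-clique u-outside-B)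

  -- If some q ∈ S ∩ Q is universal in G[S], delete it.
  -- Otherwise choose r ∈ S with a non-neighbour in S and S ∩ Q ⊆ N[r] (any
  -- q ∈ S ∩ Q will do, or any r when S ∩ Q is empty) and go beyond N[r];
  -- if there is no such r, G[S] is complete and every vertex is simplicial.
  simplicial-outside : ∀ S → SimplicialOutside S
  simplicial-outside = size-induction SimplicialOutside induction-step
    where
    QNear : Subset n → Subset n → Fin n → Set
    QNear S Q r = ∀ q → q ∈ S → q ∈ Q → q ∈N[ r ]

    FarFrom : Subset n → Fin n → Set
    FarFrom S r = ∃ λ u → u ∈ S × ¬ u ∈N[ r ]

    far? : ∀ S r → Dec (FarFrom S r)
    far? S r = any? (λ u → (u ∈? S) ×-dec ¬? (u ∈N[ r ]?))

    induction-step : ∀ S → (∀ S' → ∣ S' ∣ < ∣ S ∣ → SimplicialOutside S') → SimplicialOutside S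
    induction-step S ih Q clique (u₀ , u₀∈S , u₀∉Q)
      with any? (λ q → (q ∈? S) ×-dec (q ∈? Q) ×-dec ¬? (far? S q))
    ... | yes (q , q∈S , q∈Q , ¬far) =
      let (s , simp , s∉Q) = ih (S - q) (x∈p⇒∣p-x∣<∣p∣ q∈S) Q clique
                                (u₀ , x∈p∧x≢y⇒x∈p-y u₀∈S (λ { refl → u₀∉Q q∈Q }) , u₀∉Q)
      in s , simplicial-del-universal universal simp , s∉Q
      where
      universal : Universal S q
      universal v v∈S with v ∈N[ q ]?
      ... | yes v∈N = v∈N
      ... | no v∉N  = ⊥-elim (¬far (v , v∈S , v∉N))
    ... | no noUniversal
      with any? (λ r → (r ∈? S) ×-dec all? (λ q → (q ∈? S) →-dec (q ∈? Q) →-dec q ∈N[ r ]?) ×-dec far? S r)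
    ...   | yes (r , r∈S , near , u , u∈S , u∉N) =
      BeyondNeighbourhood.result S Q r u r∈S u∈S u∉N near (ih _ (BeyondNeighbourhood.smaller S Q r u r∈S u∈S u∉N near))
    ...   | no noCandidate = u₀ , (u₀∈S , λ a b a∈S b∈S _ _ → complete a∈S b∈S) , u₀∉Q
      where
      -- every q ∈ S ∩ Q would be a candidate r, so S ∩ Q is empty
      S∩Q-empty : ∀ q → q ∈ S → q ∉ Q
      S∩Q-empty q q∈S q∈Q with far? S q
      ... | yes far = noCandidate (q , q∈S , near , far)
        where
        near : QNear S Q q
        near q' _ q'∈Q with q ≟ᶠ q'
        ... | yes q≡q' = inj₁ q≡q'
        ... | no q≢q'  = inj₂ (clique q q' q∈Q q'∈Q q≢q')
      ... | no ¬far = noUniversal (q , q∈S , q∈Q , ¬far)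
      complete : ∀ {a b} → a ∈ S → b ∈ S → a ≢ b → Adj G a b
      complete {a} {b} a∈S b∈S a≢b with b ∈N[ a ]?
      ... | yes (inj₁ a≡b) = ⊥-elim (a≢b a≡b)
      ... | yes (inj₂ ab)  = ab
      ... | no b∉N = ⊥-elim (noCandidate (a , a∈S , (λ q q∈S q∈Q → ⊥-elim (S∩Q-empty q q∈S q∈Q)) , b , b∈S , b∉N))

  simplicial-exists : ∀ {S v} → v ∈ S → ∃ λ s → Simplicial S s
  simplicial-exists {S} {v} v∈S =
    let (s , simp , _) = simplicial-outside S ∅ (λ _ _ a∈∅ → ⊥-elim (∉⊥ a∈∅)) (v , v∈S , ∉⊥) in s , simp

module Covering {n : ℕ} (G : Graph n) (chordal : Chordal G) where

  open Basics G
  open IndependentSets G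
  open Detours G chordal using (no-square)
  open Dirac G chordal using (simplicial-exists)

  module Domination (Target Allowed : Fin n → Set)
    (target? : ∀ a → Dec (Target a)) (allowed? : ∀ y → Dec (Allowed y)) where

    Dominates : Subset n → Set
    Dominates X = (∀ y → y ∈ X → Allowed y) × (∀ a → Target a → ∃ λ y → y ∈ X × Adj G y a)

    dominates? : ∀ X → Dec (Dominates X)
    dominates? X = all? (λ y → (y ∈? X) →-dec allowed? y) ×-dec
                   all? (λ a → target? a →-dec any? (λ y → (y ∈? X) ×-dec adj? y a))

    Private : Subset n → Fin n → Fin n → Set
    Private X y a = Target a × Adj G y a × (∀ y' → y' ∈ X → Adj G y' a → y' ≡ y)

    -- In a dominating set of least size every member has a private neighbour;
    -- otherwise it could be dropped.
    least-dominating : (∀ a → Target a → ∃ λ y → Allowed y × Adj G y a) →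
      ∃ λ X → Dominates X × (∀ y → y ∈ X → ∃ (Private X y))
    least-dominating dominable = X , domX , private-nbr
      where
      dom₀ : Dominates (subsetOf allowed?)
      dom₀ = (λ _ y∈ → ∈subsetOf⁻ allowed? y∈) ,
             λ a Ta → let (y , y-ok , ya) = dominable a Ta in y , ∈subsetOf⁺ allowed? y-ok , ya
      least = leastSubset Dominates dominates? _ dom₀
      X = proj₁ least
      domX = proj₁ (proj₂ least)
      private-nbr : ∀ y → y ∈ X → ∃ (Private X y)
      private-nbr y y∈X with any? (λ a → target? a ×-dec ¬? (any? (λ y' → (y' ∈? X - y) ×-dec adj? y' a)))
      ... | yes (a , Ta , unseen) = a , Ta , subst (λ y' → Adj G y' a) (unique _ y'∈X y'a) y'a , unique
        where
        unique : ∀ y' → y' ∈ X → Adj G y' a → y' ≡ y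
        unique y' y'∈X y'a with y' ≟ᶠ y
        ... | yes y'≡y = y'≡y
        ... | no y'≢y  = ⊥-elim (unseen (y' , x∈p∧x≢y⇒x∈p-y y'∈X y'≢y , y'a))
        y'∈X = proj₁ (proj₂ (proj₂ domX a Ta))
        y'a  = proj₂ (proj₂ (proj₂ domX a Ta))
      ... | no allSeen = ⊥-elim (<⇒≱ (x∈p⇒∣p-x∣<∣p∣ y∈X) (proj₂ (proj₂ least) (X - y) dom-y))
        where
        seen : ∀ a → Target a → ∃ λ y' → y' ∈ X - y × Adj G y' a
        seen a Ta with any? (λ y' → (y' ∈? X - y) ×-dec adj? y' a)
        ... | yes s = s
        ... | no ¬s = ⊥-elim (allSeen (a , Ta , ¬s))
        dom-y : Dominates (X - y)
        dom-y = (λ y' y'∈ → proj₁ domX y' (p─q⊆p X _ y'∈)) , seen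

    -- If the targets form a clique and no target is allowed, allowed vertices
    -- with private neighbours are non-adjacent: for adjacent y₁, y₂ with private
    -- neighbours a₁, a₂ the square y₁ a₁ a₂ y₂ would be induced.
    private-independent : (∀ {a b} → Target a → Target b → a ≢ b → Adj G a b) →
      (∀ {y} → Allowed y → ¬ Target y) → ∀ X {y₁ y₂} → y₁ ∈ X → y₂ ∈ X → Allowed y₁ → Allowed y₂ →
      ∃ (Private X y₁) → ∃ (Private X y₂) → ¬ Adj G y₁ y₂
    private-independent clique disjoint X y₁∈X y₂∈X ok₁ ok₂
      (a₁ , T₁ , y₁a₁ , only₁) (a₂ , T₂ , y₂a₂ , only₂) y₁y₂ =
      no-square y₁a₁ (clique T₁ T₂ a₁≢a₂) (adj-sym y₂a₂) (adj-sym y₁y₂) ¬y₁a₂ ¬a₁y₂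
        (λ { refl → disjoint ok₂ T₁ }) (λ { refl → disjoint ok₁ T₂ })
      where
      ¬y₁a₂ : ¬ Adj G _ a₂
      ¬y₁a₂ y₁a₂ = adj⇒≢ y₁y₂ (only₂ _ y₁∈X y₁a₂)
      ¬a₁y₂ : ¬ Adj G a₁ _
      ¬a₁y₂ a₁y₂ = adj⇒≢ y₁y₂ (sym (only₁ _ y₂∈X (adj-sym a₁y₂)))
      a₁≢a₂ : a₁ ≢ a₂
      a₁≢a₂ refl = ¬y₁a₂ y₁a₁

  Covered : Subset n → Fin n → Set
  Covered S v = ∃ λ s → Simplicial S s × v ∈N[ s ]

  -- Let s₀ be simplicial in G[S] and t
  -- simplicial in G[S'] for S' = S ∖ N[s₀], so T = N[t] ∩ S' is a clique.
  -- Then some vertex of T has all its neighbours in T, hence is simplicial in G[S].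
  module SealedVertex (S : Subset n) (wc : WellCovered G S) (s₀ t : Fin n)
    (simp₀ : Simplicial S s₀) (simpt : Simplicial (S ─ closedNbhd G s₀) t) where

    S' : Subset n
    S' = S ─ closedNbhd G s₀

    InT : Fin n → Set
    InT z = z ∈ S' × z ∈N[ t ]

    inT? : ∀ z → Dec (InT z)
    inT? z = (z ∈? S') ×-dec (z ∈N[ t ]?)

    T-clique : ∀ {a b} → InT a → InT b → a ≢ b → Adj G a b
    T-clique (a∈ , a∈N) (b∈ , b∈N) = simplicial-clique simpt a∈ b∈ a∈N b∈N

    Outside : Fin n → Set
    Outside z = z ∈ S × ¬ InT z

    outside? : ∀ z → Dec (Outside z)
    outside? z = (z ∈? S) ×-dec ¬? (inT? z)

    Sealed : Fin n → Set
    Sealed u = ∀ z → z ∈ S → Adj G u z → InT z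

    sealed? : ∀ u → Dec (Sealed u)
    sealed? u = all? (λ z → (z ∈? S) →-dec adj? u z →-dec inT? z)

    sealed-simplicial : ∀ {u} → InT u → Sealed u → Simplicial S u
    sealed-simplicial (u∈S' , _) sealed =
      p─q⊆p S _ u∈S' , λ a b a∈ b∈ ua ub → T-clique (sealed a a∈ ua) (sealed b b∈ ub)

    -- Suppose every vertex of T has a neighbour outside T.  A least set X ⊆ S ∖ T
    -- dominating T is independent; extend it to a maximal independent set I of
    -- G[S], which misses T.  Then J = I ∩ S' together with t is independent in
    -- G[S'] and extends to a maximal M there, so by well-coveredness
    -- ∣I∣ = ∣M ∪ {s₀}∣ ≥ ∣J∣ + 2, while I has at most one vertex outside S'.
    module _ (escape : ∀ u → InT u → ∃ λ z → Outside z × Adj G z u) where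
      open Domination InT Outside inT? outside?

      dominating : ∃ λ X → Dominates X × (∀ y → y ∈ X → ∃ (Private X y))
      dominating = least-dominating escape

      X : Subset n
      X = proj₁ dominating

      X-outside : ∀ y → y ∈ X → Outside y
      X-outside = proj₁ (proj₁ (proj₂ dominating))

      X-dominates : ∀ a → InT a → ∃ λ y → y ∈ X × Adj G y a
      X-dominates = proj₂ (proj₁ (proj₂ dominating))

      X-independent : Independent G S X
      X-independent = (λ y y∈X → proj₁ (X-outside y y∈X)) , λ y₁ y₂ y₁∈X y₂∈X →
        private-independent T-clique proj₂ X y₁∈X y₂∈X (X-outside y₁ y₁∈X) (X-outside y₂ y₂∈X)
          (proj₂ (proj₂ dominating) y₁ y₁∈X) (proj₂ (proj₂ dominating) y₂ y₂∈X)

      extendedI : ∃ λ I → MaximalIndependent G S I × (∀ x → x ∈ X → x ∈ I)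
      extendedI = extendToMaximal S X X-independent

      I : Subset n
      I = proj₁ extendedI

      maxI : MaximalIndependent G S I
      maxI = proj₁ (proj₂ extendedI)

      independentI : Independent G S I
      independentI = proj₁ maxI

      I-misses-T : ∀ {a} → a ∈ I → ¬ InT a
      I-misses-T a∈I Ta =
        let (y , y∈X , ya) = X-dominates _ Ta in proj₂ independentI _ _ (proj₂ (proj₂ extendedI) y y∈X) a∈I ya

      J : Subset n
      J = I ∩ S'

      J-independent : Independent G S' J
      J-independent = (λ x x∈J → proj₂ (x∈p∩q⁻ I S' x∈J)) ,
        λ x y x∈J y∈J → proj₂ independentI x y (proj₁ (x∈p∩q⁻ I S' x∈J)) (proj₁ (x∈p∩q⁻ I S' y∈J))

      t-addable : Addable S' J t
      t-addable = proj₁ simpt ,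
        (λ t∈J → I-misses-T (proj₁ (x∈p∩q⁻ I S' t∈J)) (proj₁ simpt , inj₁ refl)) ,
        λ u u∈J ut → I-misses-T (proj₁ (x∈p∩q⁻ I S' u∈J)) (proj₂ (x∈p∩q⁻ I S' u∈J) , inj₂ (adj-sym ut))

      extendedM : ∃ λ M → MaximalIndependent G S' M × (∀ x → x ∈ J ∪ ⁅ t ⁆ → x ∈ M)
      extendedM = extendToMaximal S' (J ∪ ⁅ t ⁆) (add-independent J-independent t-addable)

      M : Subset n
      M = proj₁ extendedM

      maxM : MaximalIndependent G S' M
      maxM = proj₁ (proj₂ extendedM)

      s₀∉M : s₀ ∉ M
      s₀∉M s₀∈M = x∉S─N[x] (proj₁ (proj₁ maxM) s₀ s₀∈M)

      contradiction : ⊥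
      contradiction = <-irrefl refl (begin-strict
        ∣ I ∣             ≤⟨ independent-outside-link simp₀ independentI ⟩
        suc ∣ J ∣         ≡⟨ ∣p∪⁅x⁆∣≡1+∣p∣ t J (proj₁ (proj₂ t-addable)) ⟨
        ∣ J ∪ ⁅ t ⁆ ∣     ≤⟨ p⊆q⇒∣p∣≤∣q∣ (λ {x} → proj₂ (proj₂ extendedM) x) ⟩
        ∣ M ∣             <⟨ n<1+n _ ⟩
        suc ∣ M ∣         ≡⟨ ∣p∪⁅x⁆∣≡1+∣p∣ s₀ M s₀∉M ⟨
        ∣ M ∪ ⁅ s₀ ⁆ ∣    ≡⟨ wc I (M ∪ ⁅ s₀ ⁆) maxI (maximal-link (proj₁ simp₀) maxM) ⟨
        ∣ I ∣             ∎)
        where open ≤-Reasoning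

    sealed-vertex : ∃ λ u → InT u × Sealed u
    sealed-vertex with any? (λ u → inT? u ×-dec sealed? u)
    ... | yes found = found
    ... | no none = ⊥-elim (contradiction escape)
      where
      escape : ∀ u → InT u → ∃ λ z → Outside z × Adj G z u
      escape u Tu with any? (λ z → outside? z ×-dec adj? z u)
      ... | yes e = e
      ... | no ¬e = ⊥-elim (none (u , Tu , sealed))
        where
        sealed : Sealed u
        sealed z z∈S uz with inT? z
        ... | yes Tz = Tz
        ... | no ¬Tz = ⊥-elim (¬e (z , (z∈S , ¬Tz) , adj-sym uz))

  -- In a well-covered chordal graph every vertex lies in the closed
  -- neighbourhood of a simplicial vertex (induction on ∣S∣: a vertex v outside
  -- N[s₀] is covered in G[S ∖ N[s₀]] by some t, and then by a sealed vertex of N[t]).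
  covered : ∀ S → WellCovered G S → ∀ v → v ∈ S → Covered S v
  covered = size-induction (λ S → WellCovered G S → ∀ v → v ∈ S → Covered S v) step
    where
    step : ∀ S → (∀ S' → ∣ S' ∣ < ∣ S ∣ → WellCovered G S' → ∀ v → v ∈ S' → Covered S' v) →
      WellCovered G S → ∀ v → v ∈ S → Covered S v
    step S ih wc v v∈S with simplicial-exists v∈S
    ... | s₀ , simp₀ with v ∈N[ s₀ ]?
    ...   | yes v∈N = s₀ , simp₀ , v∈N
    ...   | no v∉N with ih (S ─ closedNbhd G s₀)
                         (link-smaller (proj₁ simp₀))
                         (wellCovered-link wc (proj₁ simp₀)) v (∈─N⁺ v∈S v∉N)
    ...     | t , simpt , v∈Nt with SealedVertex.sealed-vertex S wc s₀ t simp₀ simpt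
    ...       | u , Tu , sealed = u , SealedVertex.sealed-simplicial S wc s₀ t simp₀ simpt Tu sealed ,
                  v-near-u
      where
      v-near-u : v ∈N[ u ]
      v-near-u with u ≟ᶠ v
      ... | yes u≡v = inj₁ u≡v
      ... | no u≢v = inj₂ (SealedVertex.T-clique S wc s₀ t simp₀ simpt Tu (∈─N⁺ v∈S v∉N , v∈Nt) u≢v)

module ShedDomination {n : ℕ} (G : Graph n) (chordal : Chordal G) where

  open Basics G
  open IndependentSets G
  open Covering G chordal using (covered)

  -- A well-covered chordal graph is vertex decomposable: if G[S] has an edge
  -- x y, cover x by a simplicial vertex s and shed a neighbour z of s (z = y if
  -- s = x, else z = x); G[S] ∖ z and G[S] ∖ N[z] are again well-covered.
  vertex-decomposable : ∀ S → WellCovered G S → VertexDecomposable G S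
  vertex-decomposable = size-induction (λ S → WellCovered G S → VertexDecomposable G S) step
    where
    neighbour : ∀ {S s x y} → x ∈ S → y ∈ S → Adj G x y → x ∈N[ s ] → ∃ λ z → z ∈ S × Adj G s z
    neighbour _   y∈S xy (inj₁ refl) = _ , y∈S , xy
    neighbour x∈S _   _  (inj₂ sx)   = _ , x∈S , sx
    step : ∀ S → (∀ S' → ∣ S' ∣ < ∣ S ∣ → WellCovered G S' → VertexDecomposable G S') →
      WellCovered G S → VertexDecomposable G S
    step S ih wc with any? (λ x → (x ∈? S) ×-dec any? (λ y → (y ∈? S) ×-dec adj? x y))
    ... | no edgeless = vd-edgeless wc (λ x y x∈S y∈S xy → edgeless (x , x∈S , y , y∈S , xy))
    ... | yes (x , x∈S , y , y∈S , xy) =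
      let (s , simp , x∈N) = covered S wc x x∈S
          (z , z∈S , sz)   = neighbour x∈S y∈S xy x∈N
      in vd-shed wc z z∈S (ih _ (x∈p⇒∣p-x∣<∣p∣ z∈S) (wellCovered-del wc simp z∈S sz))
                          (ih _ (link-smaller z∈S) (wellCovered-link wc z∈S))

  shedding-neighbour : ∀ {S s z} → WellCovered G S → Simplicial S s → z ∈ S → Adj G s z → InShed G S z
  shedding-neighbour wc simp z∈S sz =
    z∈S , vertex-decomposable _ (wellCovered-del wc simp z∈S sz) ,
          vertex-decomposable _ (wellCovered-link wc z∈S)

  -- So are isolated vertices, for which deletion and link coincide.
  shedding-isolated : ∀ {S v} → WellCovered G S → v ∈ S → (∀ w → w ∈ S → ¬ Adj G v w) → InShed G S v
  shedding-isolated {S} {v} wc v∈S isolated =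
    v∈S , subst (VertexDecomposable G) (sym (isolated-del≡link S v isolated)) vd-link , vd-link
    where
    vd-link = vertex-decomposable _ (wellCovered-link wc v∈S)

  -- A vertex v outside Shed lies in N[s] for a simplicial s.  If v ≠ s, v
  -- would be a shedding neighbour of s; so v = s, which is not isolated (else
  -- it would shed), and any neighbour of s is a shedding vertex adjacent to v.
  shed-dominating : ∀ {S} → WellCovered G S → Dominating G S (InShed G S)
  shed-dominating {S} wc v v∈S v∉Shed with covered S wc v v∈S
  ... | s , simp , inj₂ sv = ⊥-elim (v∉Shed (shedding-neighbour wc simp v∈S sv))
  ... | s , simp , inj₁ refl with any? (λ x → (x ∈? S) ×-dec adj? s x)
  ...   | yes (x , x∈S , sx) = x , shedding-neighbour wc simp x∈S sx , x∈S , adj-sym sx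
  ...   | no isolated = ⊥-elim (v∉Shed (shedding-isolated wc v∈S (λ w w∈S sw → isolated (w , w∈S , sw))))

theorem2p12 : (n : ℕ) (G : Graph n) → Chordal G →
    VertexDecomposable G ⊤ → Dominating G ⊤ (InShed G ⊤)
theorem2p12 n G chordal vd =
  ShedDomination.shed-dominating G chordal (IndependentSets.well-covered-of G vd)
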